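{- Let $n\geqslant 5$. For each unordered pair $\{i,j\}$ of distinct elements of $\{1,\dots,n\}$, let $P(i,j)$ be the subgraph of $BS_n$ with vertex set $\{[\pi_1\dots\pi_{n-2}\,i\,j],\ [\pi_1\dots\pi_{n-2}\,j\,i]\}$ (all permutations whose last two entries are $i$ and $j$ in some order) and with the edges of $BS_n$ corresponding to $b_1,\dots,b_{n-3},b_{n-1}$ between these vertices; each $P(i,j)$ is isomorphic to the generalized prism $BS_{n-2}\times K_2$, and the $P(i,j)$ form a maximal cover of $BS_n$. Then $BS_n$ has a Hamiltonian cycle based on this cover, i.e. a Hamiltonian cycle of $BS_n$ in which, for every pair $\{i,j\}$, the vertices of $P(i,j)$ are visited consecutively (so the cycle restricted to each $P(i,j)$ is a Hamiltonian path of $P(i,j)$).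
   Context: $Sym_n$ is the symmetric group of permutations $\pi=[\pi_1\ldots\pi_n]$ of $\{1,\dots,n\}$; $b_i=(i\ i+1)$ for $1\leqslant i\leqslant n-1$, and right multiplication by $b_i$ swaps positions $i$ and $i+1$. The Bubble-sort graph $BS_n=Cay(Sym_n,\{b_1,\dots,b_{n-1}\})$ has $\pi$ adjacent to $\pi b_i$. For a graph $G$, the generalized prism is the Cartesian product $G\times K_2$. A maximal cover of a graph by copies of a subgraph $H$ is a collection of vertex-disjoint subgraphs isomorphic to $H$ such that every vertex lies in one of them. -}

module Defs where

open import Data.Nat using (ℕ; suc; _∸_; _<_; _≤_; _+_)
open import Data.Nat.DivMod using (_%_)
open import Data.Fin using (Fin; toℕ)
open import Data.Vec using (Vec; lookup)
open import Data.Product using (Σ; ∃; ∃-syntax; _×_)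
open import Data.Sum using (_⊎_)
open import Relation.Binary.PropositionalEquality using (_≡_; _≢_)
open import Function.Bundles using (_⇔_)

-- A word over {1..n} (0-indexed as Fin n) of length n; position p holds lookup π p.
Word : ℕ → Set
Word n = Vec (Fin n) n

IsPerm : ∀ {n} → Word n → Set
IsPerm {n} π = (p q : Fin n) → lookup π p ≡ lookup π q → p ≡ q

-- σ = π b_i for some generator b_i = (i i+1): σ is π with the entries at two
-- consecutive positions p, p+1 swapped and all other entries unchanged.
BSAdj : ∀ {n} → Word n → Word n → Set
BSAdj {n} π σ =
  ∃[ p ] ∃[ q ] (toℕ q ≡ suc (toℕ p)
    × lookup σ p ≡ lookup π q
    × lookup σ q ≡ lookup π p
    × ((k : Fin n) → k ≢ p → k ≢ q → lookup σ k ≡ lookup π k))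

InP : ∀ {n} → Fin n → Fin n → Word n → Set
InP {n} i j π =
  ∃[ p ] ∃[ q ] (toℕ p ≡ n ∸ 2 × toℕ q ≡ n ∸ 1
    × ((lookup π p ≡ i × lookup π q ≡ j) ⊎ (lookup π p ≡ j × lookup π q ≡ i)))

record HamCycleBS (n M : ℕ) (c : Fin (suc M) → Word n) : Set where
  field
    length≥3  : 3 ≤ suc M
    distinct  : (k l : Fin (suc M)) → c k ≡ c l → k ≡ l
    perms     : (k : Fin (suc M)) → IsPerm (c k)
    covers    : (π : Word n) → IsPerm π → ∃[ k ] (c k ≡ π)
    adjacent  : (k l : Fin (suc M)) → toℕ l ≡ suc (toℕ k) % suc M → BSAdj (c k) (c l)

-- The vertices of P(i,j) are visited consecutively by the cycle c: there is a
-- start index s and a length L such that c k ∈ P(i,j) iff k lies in the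
-- cyclic interval s, s+1, …, s+L-1 (mod N).
ConsecutiveIn : ∀ {n M} → (Fin (suc M) → Word n) → Fin n → Fin n → Set
ConsecutiveIn {n} {M} c i j =
  Σ (Fin (suc M)) λ s → Σ ℕ λ L → ((k : Fin (suc M)) →
    InP i j (c k) ⇔ ((toℕ k + (suc M ∸ toℕ s)) % suc M < L))

-- Arrangements of 0 … n-1 are lists, and the word of an arrangement reads the list backwards, so
-- P(i,j) consists of the arrangements whose first two entries are i and j: the prism over the
-- arrangements of the other n-2 letters. In the prism of (h, o) we follow the Steinhaus–Johnson–
-- Trotter Hamiltonian path of the other letters, zigzagging between the layers h o … and o h … up
-- to a chosen arrangement x and then making a U-turn. This path has an even number of vertices, so
-- it can be made to end at whichever of h o x, o h x has the sign opposite to its start.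
-- The pairs are ordered so that each pair (h′, o′) keeps one letter h′ of its predecessor (h, o)
-- in front; the exit h′ k o′ r of one prism is then adjacent to the entry h′ o′ k r of the next,
-- and r can be chosen to give the exit the required sign. Hence every prism is entered with the
-- sign of the first vertex, and the last prism can be left at a neighbour of the first vertex.

module Submission where

open import Defs

open import Data.Bool.Base using (Bool; true; false; not; if_then_else_)
open import Data.Empty using (⊥; ⊥-elim)
open import Data.Fin.Base as Fin using (Fin; toℕ; fromℕ<; opposite; punchOut)
  renaming (zero to fzero; suc to fsuc)
import Data.Fin.Properties as Fin
open import Data.List.Base as List
  using (List; []; _∷_; _++_; [_]; _∷ʳ_; map; length; reverse; drop; concat; lookup; upTo; applyUpTo; downFrom)
open import Data.List.Membership.Propositional using (_∈_; _∉_; find)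
open import Data.List.Membership.Propositional.Properties
  using (∈-∃++; ∈-++⁺ˡ; ∈-++⁺ʳ; ∈-++⁻; ∈-map⁺; map∷⁻; ∈-lookup; ∈-length; ∈-upTo⁺; ∈-upTo⁻;
         ∈-downFrom⁺; ∈-downFrom⁻; ∈-tabulate⁺; ∈-tabulate⁻)
open import Data.List.Membership.Propositional.Properties.WithK using (unique∧set⇒bag)
open import Data.List.Properties
  using (++-identityʳ; length-++; map-++; concat-++; ∷-injective; ∷-injectiveˡ; ∷-injectiveʳ;
         unfold-reverse; length-upTo; applyUpTo-∷ʳ)
open import Data.List.Relation.Binary.BagAndSetEquality using (∼bag⇒↭)
open import Data.List.Relation.Binary.Disjoint.Propositional using (Disjoint)
open import Data.List.Relation.Binary.Permutation.Propositional
  using (_↭_; ↭-refl; ↭-prep; ↭-swap; ↭-trans; ↭-sym; ↭-reflexive; ↭⇒↭ₛ)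
open import Data.List.Relation.Binary.Permutation.Propositional.Properties
  using (∈-resp-↭; drop-mid; drop-∷; ↭-empty-inv; ↭-length; shift; ↭-reverse; ∷↭∷ʳ)
import Data.List.Relation.Binary.Permutation.Setoid.Properties as PermutationSetoid
open import Data.List.Relation.Unary.All as All using (All; []; _∷_)
import Data.List.Relation.Unary.All.Properties as All
open import Data.List.Relation.Unary.AllPairs as AllPairs using (AllPairs; []; _∷_)
import Data.List.Relation.Unary.AllPairs.Properties as AllPairs
open import Data.List.Relation.Unary.Any as Any using (Any; here; there)
import Data.List.Relation.Unary.Any.Properties as Any
open import Data.List.Relation.Unary.Linked using (Linked; []; [-]; _∷_)
open import Data.List.Relation.Unary.Unique.Propositional using (Unique)
import Data.List.Relation.Unary.Unique.Propositional.Properties as Unique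
open import Data.Nat.Base using (ℕ; zero; suc; _+_; _∸_; _≤_; _<_; _<ᵇ_; s≤s; z≤n; NonZero; parity)
open import Data.Nat.DivMod using (_%_; _mod_; m<n⇒m%n≡m; [m+n]%n≡m%n; n%n≡0)
open import Data.Nat.Properties
  using (+-suc; +-comm; +-assoc; +-∸-assoc; m≤m+n; m≤n+m; m<m+n; suc-injective; ≤-refl; ≤-trans;
         ≤-pred; ≤-<-trans; <-≤-trans; n≤1+n; n<1+n; <-trans; <⇒≤; <⇒≢; <⇒≱; ≰⇒>; <-irrefl; <-cmp;
         _≤?_; 1+n≰n; m≤n⇒m<n∨m≡n; +-monoʳ-≤; +-monoʳ-<; +-monoˡ-<; ∸-monoˡ-≤; ∸-monoˡ-<; m∸n≤m;
         m∸n+n≡m; m+[n∸m]≡n; m+n∸m≡n; m+n∸n≡m; n∸n≡0; module ≤-Reasoning)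
open import Data.Parity.Base using (Parity; 0ℙ; 1ℙ; _⁻¹) renaming (_+_ to _⊕_)
open import Data.Parity.Properties
  using (suc-homo-⁻¹; +-homo-+; p+p≡0ℙ; ⁻¹-involutive; p≢p⁻¹; +-0-commutativeMonoid)
  renaming (_≟_ to _≟ₚ_)
open import Algebra.Solver.CommutativeMonoid +-0-commutativeMonoid
  using (solve; _⊜_) renaming (_⊕_ to _⊞_)
open import Data.Product using (∃; ∃₂; ∃-syntax; _×_; _,_; proj₁; proj₂; uncurry)
open import Data.Sum using (_⊎_; inj₁; inj₂)
import Data.Vec.Base as Vec
import Data.Vec.Properties as Vec
open import Function.Base using (_∘_)
open import Function.Bundles using (_⇔_; mk⇔; Equivalence)
open import Function.Properties.Equivalence using () renaming (trans to ⇔-trans; sym to ⇔-sym)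
open import Relation.Binary.Definitions using (tri<; tri≈; tri>)
open import Relation.Binary.PropositionalEquality
  using (_≡_; _≢_; refl; sym; trans; cong; cong₂; subst; setoid; module ≡-Reasoning)
open import Relation.Nullary using (¬_; yes; no)

infix 4 _⇄_

data _⇄_ : List ℕ → List ℕ → Set where
  swap : ∀ {x y r} → x ≢ y → x ∷ y ∷ r ⇄ y ∷ x ∷ r
  skip : ∀ {z u v} → u ⇄ v → z ∷ u ⇄ z ∷ v

⇄-sym : ∀ {u v} → u ⇄ v → v ⇄ u
⇄-sym (swap x≢y) = swap (x≢y ∘ sym)
⇄-sym (skip a)   = skip (⇄-sym a)

⇄⇒↭ : ∀ {u v} → u ⇄ v → u ↭ v
⇄⇒↭ (swap {x} {y} _) = ↭-swap x y ↭-refl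
⇄⇒↭ (skip {z} a)     = ↭-prep z (⇄⇒↭ a)

⇄-∷ʳ : ∀ {u v} t → u ⇄ v → u ∷ʳ t ⇄ v ∷ʳ t
⇄-∷ʳ t (swap x≢y) = swap x≢y
⇄-∷ʳ t (skip a)   = skip (⇄-∷ʳ t a)

data Path : List ℕ → List ℕ → List (List ℕ) → Set where
  stop : ∀ {u} → Path u u [ u ]
  step : ∀ {u w v L} → u ⇄ w → Path w v L → Path u v (u ∷ L)

Path-join : ∀ {u v w z L M} → Path u v L → v ⇄ w → Path w z M → Path u z (L ++ M)
Path-join stop       a q = step a q
Path-join (step b p) a q = step b (Path-join p a q)

Path-map : ∀ (f : List ℕ → List ℕ) → (∀ {u v} → u ⇄ v → f u ⇄ f v) →
           ∀ {u v L} → Path u v L → Path (f u) (f v) (map f L)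
Path-map f f⇄ stop       = stop
Path-map f f⇄ (step a p) = step (f⇄ a) (Path-map f f⇄ p)

Path-head : ∀ {u v w L} → Path u v (w ∷ L) → u ≡ w
Path-head stop       = refl
Path-head (step _ _) = refl

Path-uncons : ∀ {u v w L} → Path u v (u ∷ w ∷ L) → u ⇄ w × Path w v (w ∷ L)
Path-uncons (step a p) with Path-head p
... | refl = a , p

Path-unstep : ∀ {u v} P {x Q} → Path u v (u ∷ P ++ x ∷ Q) → ∃ λ w → u ⇄ w × Path w v (P ++ x ∷ Q)
Path-unstep []      (step a p) = _ , a , p
Path-unstep (_ ∷ _) (step a p) = _ , a , p

Path-∷ : ∀ {u v L} → Path u v L → ∃ λ L′ → L ≡ u ∷ L′
Path-∷ stop       = [] , refl
Path-∷ (step _ _) = _ , refl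

Path-reverse : ∀ {u v L} → Path u v L → Path v u (reverse L)
Path-reverse stop               = stop
Path-reverse (step {u} {L = L} a p) =
  subst (Path _ u) (sym (unfold-reverse u L)) (Path-join (Path-reverse p) (⇄-sym a) stop)

Unique-resp-↭ : ∀ {A : Set} {xs ys : List A} → xs ↭ ys → Unique ys → Unique xs
Unique-resp-↭ p = PermutationSetoid.Unique-resp-↭ (setoid _) (↭⇒↭ₛ (↭-sym p))

-- The Steinhaus–Johnson–Trotter path

split-injective : ∀ {A : Set} {t : A} as bs cs ds → t ∉ as ++ bs → t ∉ cs ++ ds →
                  as ++ t ∷ bs ≡ cs ++ t ∷ ds → as ++ bs ≡ cs ++ ds
split-injective []       bs []       ds _  _  refl = refl
split-injective []       bs (c ∷ cs) ds _  t∉ refl = ⊥-elim (t∉ (here refl))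
split-injective (a ∷ as) bs []       ds t∉ _  refl = ⊥-elim (t∉ (here refl))
split-injective (a ∷ as) bs (c ∷ cs) ds t∉ t∉′ eq =
  cong₂ _∷_ (proj₁ (∷-injective eq))
            (split-injective as bs cs ds (t∉ ∘ there) (t∉′ ∘ there) (proj₂ (∷-injective eq)))

sweepʳ : ℕ → List ℕ → List (List ℕ)
sweepʳ t []      = [ [ t ] ]
sweepʳ t (x ∷ w) = (t ∷ x ∷ w) ∷ map (x ∷_) (sweepʳ t w)

sweepʳ-path : ∀ {t} w → t ∉ w → Path (t ∷ w) (w ∷ʳ t) (sweepʳ t w)
sweepʳ-path []      _  = stop
sweepʳ-path (x ∷ w) t∉ = step (swap (t∉ ∘ here)) (Path-map (x ∷_) skip (sweepʳ-path w (t∉ ∘ there)))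

∈-sweepʳ⁻ : ∀ {t} w {v} → v ∈ sweepʳ t w → ∃₂ λ as bs → w ≡ as ++ bs × v ≡ as ++ t ∷ bs
∈-sweepʳ⁻ []      (here refl) = [] , [] , refl , refl
∈-sweepʳ⁻ (x ∷ w) (here refl) = [] , x ∷ w , refl , refl
∈-sweepʳ⁻ (x ∷ w) (there m) with map∷⁻ m
... | u , u∈ , refl with ∈-sweepʳ⁻ w u∈
... | as , bs , refl , refl = x ∷ as , bs , refl , refl

∈-sweepʳ⁺ : ∀ t as bs → as ++ t ∷ bs ∈ sweepʳ t (as ++ bs)
∈-sweepʳ⁺ t []       []       = here refl
∈-sweepʳ⁺ t []       (b ∷ bs) = here refl
∈-sweepʳ⁺ t (a ∷ as) bs = there (∈-map⁺ (a ∷_) (∈-sweepʳ⁺ t as bs))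

sweepʳ-unique : ∀ {t} w → t ∉ w → Unique (sweepʳ t w)
sweepʳ-unique []      _  = [] ∷ []
sweepʳ-unique (x ∷ w) t∉ =
  All.tabulate head≢ ∷ Unique.map⁺ (proj₂ ∘ ∷-injective) (sweepʳ-unique w (t∉ ∘ there))
  where
  head≢ : ∀ {v} → v ∈ map (x ∷_) (sweepʳ _ w) → _ ≢ v
  head≢ m eq with map∷⁻ m
  ... | _ , _ , refl = t∉ (here (∷-injectiveˡ eq))

sweep : Bool → ℕ → List ℕ → List (List ℕ)
sweep true  t w = sweepʳ t w
sweep false t w = reverse (sweepʳ t w)

sweep-↭ : ∀ b t w → sweep b t w ↭ sweepʳ t w
sweep-↭ true  t w = ↭-refl
sweep-↭ false t w = ↭-reverse (sweepʳ t w)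

sweepStart sweepEnd : Bool → ℕ → List ℕ → List ℕ
sweepStart true  t w = t ∷ w
sweepStart false t w = w ∷ʳ t
sweepEnd   true  t w = w ∷ʳ t
sweepEnd   false t w = t ∷ w

sweep-path : ∀ b {t} w → t ∉ w → Path (sweepStart b t w) (sweepEnd b t w) (sweep b t w)
sweep-path true  w t∉ = sweepʳ-path w t∉
sweep-path false w t∉ = Path-reverse (sweepʳ-path w t∉)

sweepEnd-⇄ : ∀ b t {u w} → u ⇄ w → sweepEnd b t u ⇄ sweepStart (not b) t w
sweepEnd-⇄ true  t a = ⇄-∷ʳ t a
sweepEnd-⇄ false t a = skip a

sweeps : Bool → ℕ → List (List ℕ) → List (List ℕ)
sweeps b t []       = []
sweeps b t (w ∷ ws) = sweep b t w ++ sweeps (not b) t ws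

johnsonTrotter : List ℕ → List (List ℕ)
johnsonTrotter []       = [ [] ]
johnsonTrotter (t ∷ ts) = sweeps true t (johnsonTrotter ts)

module _ {t : ℕ} where

  ∈-sweeps⁻ : ∀ b L {v} → v ∈ sweeps b t L → ∃ λ w → w ∈ L × v ∈ sweepʳ t w
  ∈-sweeps⁻ b (w ∷ ws) m with ∈-++⁻ (sweep b t w) m
  ... | inj₁ m₁ = w , here refl , ∈-resp-↭ (sweep-↭ b t w) m₁
  ... | inj₂ m₂ with ∈-sweeps⁻ (not b) ws m₂
  ... | w′ , w′∈ , m′ = w′ , there w′∈ , m′

  ∈-sweeps⁺ : ∀ b {L w v} → w ∈ L → v ∈ sweepʳ t w → v ∈ sweeps b t L
  ∈-sweeps⁺ b {w ∷ ws} (here refl) m = ∈-++⁺ˡ (∈-resp-↭ (↭-sym (sweep-↭ b t w)) m)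
  ∈-sweeps⁺ b {w ∷ ws} (there w′∈) m = ∈-++⁺ʳ (sweep b t w) (∈-sweeps⁺ (not b) w′∈ m)

  sweeps-unique : ∀ b L → Unique L → (∀ {w} → w ∈ L → t ∉ w) → Unique (sweeps b t L)
  sweeps-unique b []       _          _   = []
  sweeps-unique b (w ∷ ws) (w∉ ∷ ws!) t∉ =
    Unique.++⁺ (Unique-resp-↭ (sweep-↭ b t w) (sweepʳ-unique w (t∉ (here refl))))
               (sweeps-unique (not b) ws ws! (t∉ ∘ there))
               disjoint
    where
    disjoint : ∀ {v} → v ∈ sweep b t w × v ∈ sweeps (not b) t ws → ⊥
    disjoint (m , m′) with ∈-sweepʳ⁻ w (∈-resp-↭ (sweep-↭ b t w) m) | ∈-sweeps⁻ (not b) ws m′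
    ... | as , bs , refl , refl | w′ , w′∈ , m″ with ∈-sweepʳ⁻ w′ m″
    ... | cs , ds , refl , eq =
      All.lookup w∉ w′∈ (split-injective as bs cs ds (t∉ (here refl)) (t∉ (there w′∈)) eq)

  sweeps-path : ∀ b {u z L} → Path u z L → (∀ {w} → w ∈ L → t ∉ w) →
                    ∃ λ e → Path (sweepStart b t u) e (sweeps b t L)
  sweeps-path b {u} stop t∉ =
    sweepEnd b t u , subst (Path _ _) (sym (++-identityʳ _)) (sweep-path b u (t∉ (here refl)))
  sweeps-path b {u} (step a p) t∉ with sweeps-path (not b) p (t∉ ∘ there)
  ... | e , q = e , Path-join (sweep-path b u (t∉ (here refl))) (sweepEnd-⇄ b t a) q

∈-johnsonTrotter⁻ : ∀ S {w} → w ∈ johnsonTrotter S → w ↭ S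
∈-johnsonTrotter⁻ []       (here refl) = ↭-refl
∈-johnsonTrotter⁻ (t ∷ ts) m with ∈-sweeps⁻ true (johnsonTrotter ts) m
... | w , w∈ , m′ with ∈-sweepʳ⁻ w m′
... | as , bs , refl , refl = ↭-trans (shift t as bs) (↭-prep t (∈-johnsonTrotter⁻ ts w∈))

∉-johnsonTrotter : ∀ {t ts} → t ∉ ts → ∀ {w} → w ∈ johnsonTrotter ts → t ∉ w
∉-johnsonTrotter {ts = ts} t∉ w∈ = t∉ ∘ ∈-resp-↭ (∈-johnsonTrotter⁻ ts w∈)

∈-johnsonTrotter⁺ : ∀ S → Unique S → ∀ {w} → w ↭ S → w ∈ johnsonTrotter S
∈-johnsonTrotter⁺ []       _          p with ↭-empty-inv p
... | refl = here refl
∈-johnsonTrotter⁺ (t ∷ ts) (_ ∷ ts!) p with ∈-∃++ (∈-resp-↭ (↭-sym p) (here refl))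
... | as , bs , refl =
  ∈-sweeps⁺ true (∈-johnsonTrotter⁺ ts ts! (drop-mid as [] p)) (∈-sweepʳ⁺ t as bs)

johnsonTrotter-unique : ∀ S → Unique S → Unique (johnsonTrotter S)
johnsonTrotter-unique []       _          = [] ∷ []
johnsonTrotter-unique (t ∷ ts) (t∉ ∷ ts!) =
  sweeps-unique true (johnsonTrotter ts) (johnsonTrotter-unique ts ts!) (∉-johnsonTrotter (All.All¬⇒¬Any t∉))

johnsonTrotter-path : ∀ S → Unique S → ∃ λ e → Path S e (johnsonTrotter S)
johnsonTrotter-path []       _          = [] , stop
johnsonTrotter-path (t ∷ ts) (t∉ ∷ ts!) with johnsonTrotter-path ts ts!
... | _ , p = sweeps-path true p (∉-johnsonTrotter (All.All¬⇒¬Any t∉))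

-- Signs

fromBool : Bool → Parity
fromBool b = if b then 1ℙ else 0ℙ

<ᵇ-flip : ∀ {x y} → x ≢ y → fromBool (x <ᵇ y) ≡ fromBool (y <ᵇ x) ⁻¹
<ᵇ-flip {zero}  {zero}  x≢y = ⊥-elim (x≢y refl)
<ᵇ-flip {zero}  {suc y} _   = refl
<ᵇ-flip {suc x} {zero}  _   = refl
<ᵇ-flip {suc x} {suc y} x≢y = <ᵇ-flip (x≢y ∘ cong suc)

countBelow : ℕ → List ℕ → Parity
countBelow x []      = 0ℙ
countBelow x (y ∷ w) = fromBool (y <ᵇ x) ⊕ countBelow x w

sign : List ℕ → Parity
sign []      = 0ℙ
sign (x ∷ w) = countBelow x w ⊕ sign w

countBelow-⇄ : ∀ z {u v} → u ⇄ v → countBelow z v ≡ countBelow z u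
countBelow-⇄ z (swap {x} {y} {r} _) =
  solve 3 (λ a b c → a ⊞ (b ⊞ c) ⊜ b ⊞ (a ⊞ c)) refl
    (fromBool (y <ᵇ z)) (fromBool (x <ᵇ z)) (countBelow z r)
countBelow-⇄ z (skip {y} a) = cong (fromBool (y <ᵇ z) ⊕_) (countBelow-⇄ z a)

⇄-sign : ∀ {u v} → u ⇄ v → sign v ≡ sign u ⁻¹
⇄-sign (swap {x} {y} {r} x≢y) rewrite <ᵇ-flip x≢y =
  transpose (fromBool (y <ᵇ x)) (countBelow y r) (countBelow x r) (sign r)
  where
  -- p ⁻¹ is 1ℙ ⊕ p by definition, so this is an identity of commutative monoids.
  transpose : ∀ a b c d → a ⁻¹ ⊕ b ⊕ (c ⊕ d) ≡ (a ⊕ c ⊕ (b ⊕ d)) ⁻¹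
  transpose a b c d =
    solve 5 (λ i a b c d → ((i ⊞ a) ⊞ b) ⊞ (c ⊞ d) ⊜ i ⊞ ((a ⊞ c) ⊞ (b ⊞ d))) refl 1ℙ a b c d
⇄-sign (skip {z} {u} a) rewrite countBelow-⇄ z a | ⇄-sign a =
  solve 3 (λ i p q → p ⊞ (i ⊞ q) ⊜ i ⊞ (p ⊞ q)) refl 1ℙ (countBelow z u) (sign u)

⁻¹-⊕-⁻¹ : ∀ p q → p ⁻¹ ⊕ q ⁻¹ ≡ p ⊕ q
⁻¹-⊕-⁻¹ 0ℙ q = ⁻¹-involutive q
⁻¹-⊕-⁻¹ 1ℙ q = refl

Path-sign : ∀ {u v L} → Path u v L → sign v ≡ parity (length L) ⁻¹ ⊕ sign u
Path-sign stop = refl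
Path-sign {u} {v} (step {w = w} {L = L} a p) = begin
  sign v                                ≡⟨ Path-sign p ⟩
  parity (length L) ⁻¹ ⊕ sign w         ≡⟨ cong (parity (length L) ⁻¹ ⊕_) (⇄-sign a) ⟩
  parity (length L) ⁻¹ ⊕ sign u ⁻¹      ≡⟨ ⁻¹-⊕-⁻¹ (parity (length L)) (sign u) ⟩
  parity (length L) ⊕ sign u            ≡⟨ cong (_⊕ sign u) (sym (suc-homo-⁻¹ (length L))) ⟩
  parity (suc (length L)) ⁻¹ ⊕ sign u   ∎
  where open ≡-Reasoning

⇄-sign-choice : ∀ {u v} → u ⇄ v → ∀ s → sign u ≡ s ⊎ sign v ≡ s
⇄-sign-choice {u} a s with sign u ≟ₚ s
... | yes eq = inj₁ eq
... | no  ne = inj₂ (trans (⇄-sign a) (flip (sign u) s ne))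
  where
  flip : ∀ p q → p ≢ q → p ⁻¹ ≡ q
  flip 0ℙ 0ℙ ne = ⊥-elim (ne refl)
  flip 0ℙ 1ℙ _  = refl
  flip 1ℙ 0ℙ _  = refl
  flip 1ℙ 1ℙ ne = ⊥-elim (ne refl)

-- Prisms

PrismVertex : ℕ → ℕ → List ℕ → List ℕ → Set
PrismVertex h o w v = v ≡ h ∷ o ∷ w ⊎ v ≡ o ∷ h ∷ w

PrismVertex-swap : ∀ {h o w v} → PrismVertex h o w v → PrismVertex o h w v
PrismVertex-swap (inj₁ eq) = inj₂ eq
PrismVertex-swap (inj₂ eq) = inj₁ eq

PrismVertex-sign-injective : ∀ {h o x u v} → h ≢ o → PrismVertex h o x u → PrismVertex h o x v →
                             sign u ≡ sign v → u ≡ v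
PrismVertex-sign-injective _   (inj₁ refl) (inj₁ refl) _  = refl
PrismVertex-sign-injective _   (inj₂ refl) (inj₂ refl) _  = refl
PrismVertex-sign-injective {x = x} h≢o (inj₁ refl) (inj₂ refl) eq =
  ⊥-elim (p≢p⁻¹ _ (trans eq (⇄-sign (swap {r = x} h≢o))))
PrismVertex-sign-injective {x = x} h≢o (inj₂ refl) (inj₁ refl) eq =
  ⊥-elim (p≢p⁻¹ _ (trans eq (⇄-sign (swap {r = x} (h≢o ∘ sym)))))

uturn : ℕ → ℕ → List (List ℕ) → List (List ℕ)
uturn h o []      = []
uturn h o (x ∷ Q) = (h ∷ o ∷ x) ∷ (uturn h o Q ++ [ o ∷ h ∷ x ])

prismPath : ℕ → ℕ → List (List ℕ) → List (List ℕ) → List (List ℕ)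
prismPath h o []      Q = uturn h o Q
prismPath h o (w ∷ P) Q = (h ∷ o ∷ w) ∷ (o ∷ h ∷ w) ∷ prismPath o h P Q

prismEnd : ℕ → ℕ → List (List ℕ) → List ℕ → List ℕ
prismEnd h o []      x = o ∷ h ∷ x
prismEnd h o (_ ∷ P) x = prismEnd o h P x

prismEnd-vertex : ∀ h o P x → PrismVertex h o x (prismEnd h o P x)
prismEnd-vertex h o []      x = inj₂ refl
prismEnd-vertex h o (_ ∷ P) x = PrismVertex-swap (prismEnd-vertex o h P x)

uturn-path : ∀ {h o} → h ≢ o → ∀ {x z} Q → Path x z (x ∷ Q) →
             Path (h ∷ o ∷ x) (o ∷ h ∷ x) (uturn h o (x ∷ Q))
uturn-path h≢o []      _ = step (swap h≢o) stop
uturn-path h≢o (_ ∷ Q) p with Path-uncons p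
... | a , q = step (skip (skip a)) (Path-join (uturn-path h≢o Q q) (skip (skip (⇄-sym a))) stop)

prismPath-path : ∀ {h o} → h ≢ o → ∀ P {x Q u z} → Path u z (P ++ x ∷ Q) →
                 Path (h ∷ o ∷ u) (prismEnd h o P x) (prismPath h o P (x ∷ Q))
prismPath-path h≢o []      {Q = Q} p with Path-head p
... | refl = uturn-path h≢o Q p
prismPath-path h≢o (w ∷ P) p with Path-head p
... | refl with Path-unstep P p
... | _ , a , q = step (swap h≢o) (step (skip (skip a)) (prismPath-path (h≢o ∘ sym) P q))

module _ {h o : ℕ} where

  ∈-uturn⁻ : ∀ Q {v} → v ∈ uturn h o Q → ∃ λ w → w ∈ Q × PrismVertex h o w v
  ∈-uturn⁻ (x ∷ Q) (here refl) = x , here refl , inj₁ refl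
  ∈-uturn⁻ (x ∷ Q) (there m) with ∈-++⁻ (uturn h o Q) m
  ... | inj₁ m′ with ∈-uturn⁻ Q m′
  ...   | w , w∈ , pv = w , there w∈ , pv
  ∈-uturn⁻ (x ∷ Q) (there m) | inj₂ (here refl) = x , here refl , inj₂ refl

  ∈-uturn⁺ : ∀ Q {w v} → w ∈ Q → PrismVertex h o w v → v ∈ uturn h o Q
  ∈-uturn⁺ (x ∷ Q) (here refl) (inj₁ refl) = here refl
  ∈-uturn⁺ (x ∷ Q) (here refl) (inj₂ refl) = there (∈-++⁺ʳ (uturn h o Q) (here refl))
  ∈-uturn⁺ (x ∷ Q) (there w∈) pv           = there (∈-++⁺ˡ (∈-uturn⁺ Q w∈ pv))

∈-prismPath⁻ : ∀ h o P Q {v} → v ∈ prismPath h o P Q → ∃ λ w → w ∈ P ++ Q × PrismVertex h o w v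
∈-prismPath⁻ h o []      Q m                   = ∈-uturn⁻ Q m
∈-prismPath⁻ h o (w ∷ P) Q (here refl)         = w , here refl , inj₁ refl
∈-prismPath⁻ h o (w ∷ P) Q (there (here refl)) = w , here refl , inj₂ refl
∈-prismPath⁻ h o (w ∷ P) Q (there (there m)) with ∈-prismPath⁻ o h P Q m
... | w′ , w′∈ , pv = w′ , there w′∈ , PrismVertex-swap pv

∈-prismPath⁺ : ∀ h o P Q {w v} → w ∈ P ++ Q → PrismVertex h o w v → v ∈ prismPath h o P Q
∈-prismPath⁺ h o []      Q w∈          pv          = ∈-uturn⁺ Q w∈ pv
∈-prismPath⁺ h o (w ∷ P) Q (here refl) (inj₁ refl) = here refl
∈-prismPath⁺ h o (w ∷ P) Q (here refl) (inj₂ refl) = there (here refl)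
∈-prismPath⁺ h o (w ∷ P) Q (there w∈)  pv          =
  there (there (∈-prismPath⁺ o h P Q w∈ (PrismVertex-swap pv)))

PrismVertex-tail : ∀ {h o w v} → PrismVertex h o w v → drop 2 v ≡ w
PrismVertex-tail (inj₁ refl) = refl
PrismVertex-tail (inj₂ refl) = refl

uturn-unique : ∀ {h o} Q → h ≢ o → Unique Q → Unique (uturn h o Q)
uturn-unique []      _   _          = []
uturn-unique {h} {o} (x ∷ Q) h≢o (x∉ ∷ Q!) =
  All.tabulate first≢ ∷ Unique.++⁺ (uturn-unique Q h≢o Q!) ([] ∷ []) disjoint
  where
  first≢ : ∀ {v} → v ∈ uturn h o Q ++ [ o ∷ h ∷ x ] → h ∷ o ∷ x ≢ v
  first≢ m eq with ∈-++⁻ (uturn h o Q) m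
  ... | inj₁ m′ with ∈-uturn⁻ Q m′
  ...   | w , w∈ , pv = All.lookup x∉ w∈ (trans (cong (drop 2) eq) (PrismVertex-tail pv))
  first≢ m eq | inj₂ (here refl) = h≢o (∷-injectiveˡ eq)
  disjoint : ∀ {v} → v ∈ uturn h o Q × v ∈ [ o ∷ h ∷ x ] → ⊥
  disjoint (m , here refl) with ∈-uturn⁻ Q m
  ... | w , w∈ , pv = All.lookup x∉ w∈ (PrismVertex-tail pv)

prismPath-unique : ∀ {h o} P Q → h ≢ o → Unique (P ++ Q) → Unique (prismPath h o P Q)
prismPath-unique []      Q h≢o Q!          = uturn-unique Q h≢o Q!
prismPath-unique {h} {o} (w ∷ P) Q h≢o (w∉ ∷ PQ!) =
  All.tabulate first≢ ∷ All.tabulate later≢ ∷ prismPath-unique P Q (h≢o ∘ sym) PQ!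
  where
  later≢ : ∀ {a b v} → v ∈ prismPath o h P Q → a ∷ b ∷ w ≢ v
  later≢ m eq with ∈-prismPath⁻ o h P Q m
  ... | w′ , w′∈ , pv = All.lookup w∉ w′∈ (trans (cong (drop 2) eq) (PrismVertex-tail pv))
  first≢ : ∀ {v} → v ∈ (o ∷ h ∷ w) ∷ prismPath o h P Q → h ∷ o ∷ w ≢ v
  first≢ (here refl) eq = h≢o (∷-injectiveˡ eq)
  first≢ (there m)      = later≢ m

length-uturn : ∀ h o Q → length (uturn h o Q) ≡ length Q + length Q
length-uturn h o []      = refl
length-uturn h o (x ∷ Q) = cong suc (begin
  length (uturn h o Q ++ [ o ∷ h ∷ x ]) ≡⟨ length-++ (uturn h o Q) ⟩
  length (uturn h o Q) + 1              ≡⟨ cong (_+ 1) (length-uturn h o Q) ⟩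
  length Q + length Q + 1               ≡⟨ +-comm _ 1 ⟩
  suc (length Q + length Q)             ≡⟨ +-suc (length Q) (length Q) ⟨
  length Q + suc (length Q)             ∎)
  where open ≡-Reasoning

length-prismPath : ∀ h o P Q → length (prismPath h o P Q) ≡ length (P ++ Q) + length (P ++ Q)
length-prismPath h o []      Q = length-uturn h o Q
length-prismPath h o (w ∷ P) Q =
  cong suc (trans (cong suc (length-prismPath o h P Q)) (sym (+-suc (length (P ++ Q)) _)))

record PrismBlock (h o : ℕ) (A T : List ℕ) : Set where
  field
    vertices : List (List ℕ)
    path     : Path (h ∷ o ∷ A) T vertices
    unique   : Unique vertices
    sound    : ∀ {v} → v ∈ vertices → ∃ λ w → w ↭ A × PrismVertex h o w v
    complete : ∀ {w v} → w ↭ A → PrismVertex h o w v → v ∈ vertices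

-- The path has an even number of vertices, so its end has the sign opposite to its start;
-- of the two prism vertices over x only T has that sign.
prismBlock : ∀ {h o A x T} → h ≢ o → Unique A → x ↭ A → PrismVertex h o x T →
             sign T ≡ sign (h ∷ o ∷ A) ⁻¹ → PrismBlock h o A T
prismBlock {h} {o} {A} {x} {T} h≢o A! x↭A T-vertex T-sign
  with ∈-∃++ (∈-johnsonTrotter⁺ A A! x↭A) | johnsonTrotter-path A A!
... | P , Q , eq | _ , p = record
  { vertices = prismPath h o P (x ∷ Q)
  ; path     = subst (λ E → Path _ E _) end≡T path′
  ; unique   = prismPath-unique P (x ∷ Q) h≢o (subst Unique eq (johnsonTrotter-unique A A!))
  ; sound    = sound
  ; complete = λ w↭A pv → ∈-prismPath⁺ h o P (x ∷ Q) (subst (_ ∈_) eq (∈-johnsonTrotter⁺ A A! w↭A)) pv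
  }
  where
  path′ : Path (h ∷ o ∷ A) (prismEnd h o P x) (prismPath h o P (x ∷ Q))
  path′ = prismPath-path h≢o P (subst (Path A _) eq p)
  even : parity (length (prismPath h o P (x ∷ Q))) ≡ 0ℙ
  even = trans (cong parity (length-prismPath h o P (x ∷ Q))) (trans (+-homo-+ k k) (p+p≡0ℙ (parity k)))
    where k = length (P ++ x ∷ Q)
  end≡T : prismEnd h o P x ≡ T
  end≡T = PrismVertex-sign-injective h≢o (prismEnd-vertex h o P x) T-vertex
            (trans (Path-sign path′) (trans (cong (λ q → q ⁻¹ ⊕ sign (h ∷ o ∷ A)) even) (sym T-sign)))
  sound : ∀ {v} → v ∈ prismPath h o P (x ∷ Q) → ∃ λ w → w ↭ A × PrismVertex h o w v
  sound m with ∈-prismPath⁻ h o P (x ∷ Q) m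
  ... | w , w∈ , pv = w , ∈-johnsonTrotter⁻ A (subst (w ∈_) (sym eq) w∈) , pv

∈⇒front : ∀ {e : ℕ} {xs} → e ∈ xs → ∃ λ r → e ∷ r ↭ xs
∈⇒front e∈ with ∈-∃++ e∈
... | as , bs , refl = as ++ bs , ↭-sym (shift _ as bs)

-- Swapping the two entries after e flips the sign, so one of the two choices has sign s.
sign-adjusted : ∀ a b {e xs} → e ∈ xs → 3 ≤ length xs → Unique xs → ∀ s →
                ∃ λ r → e ∷ r ↭ xs × sign (a ∷ b ∷ e ∷ r) ≡ s
sign-adjusted a b {e} {xs} e∈ 3≤|xs| xs! s with ∈⇒front e∈
... | r , er↭ = adjust r er↭ (subst (3 ≤_) (sym (↭-length er↭)) 3≤|xs|)
  where
  adjust : ∀ r → e ∷ r ↭ xs → 3 ≤ suc (length r) → ∃ λ r → e ∷ r ↭ xs × sign (a ∷ b ∷ e ∷ r) ≡ s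
  adjust (y ∷ z ∷ rest) er↭ _ with Unique-resp-↭ er↭ xs!
  ... | _ ∷ (y≢z ∷ _) ∷ _ with ⇄-sign-choice (skip {a} (skip {b} (skip {e} (swap {r = rest} y≢z)))) s
  ...   | inj₁ eq = y ∷ z ∷ rest , er↭ , eq
  ...   | inj₂ eq = z ∷ y ∷ rest , ↭-trans (↭-prep _ (↭-swap z y ↭-refl)) er↭ , eq
  adjust []          _ (s≤s ())
  adjust (_ ∷ [])    _ (s≤s (s≤s ()))

-- The order of the pairs

Pair : Set
Pair = ℕ × ℕ

InPrism : Pair → List ℕ → Set
InPrism (h , o) v = ∃ λ w → PrismVertex h o w v

_≈ₚ_ : Pair → Pair → Set
(a , b) ≈ₚ (c , d) = (a ≡ c × b ≡ d) ⊎ (a ≡ d × b ≡ c)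

≈ₚ-sym : ∀ {p q} → p ≈ₚ q → q ≈ₚ p
≈ₚ-sym (inj₁ (refl , refl)) = inj₁ (refl , refl)
≈ₚ-sym (inj₂ (refl , refl)) = inj₂ (refl , refl)

InPrism-≈ₚ : ∀ {p q v} → p ≈ₚ q → InPrism p v → InPrism q v
InPrism-≈ₚ (inj₁ (refl , refl)) pv       = pv
InPrism-≈ₚ (inj₂ (refl , refl)) (w , pv) = w , PrismVertex-swap pv

InPrism-≈ₚ⁻ : ∀ {p q v} → InPrism p v → InPrism q v → p ≈ₚ q
InPrism-≈ₚ⁻ (_ , inj₁ refl) (_ , inj₁ refl) = inj₁ (refl , refl)
InPrism-≈ₚ⁻ (_ , inj₁ refl) (_ , inj₂ refl) = inj₂ (refl , refl)
InPrism-≈ₚ⁻ (_ , inj₂ refl) (_ , inj₁ refl) = inj₂ (refl , refl)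
InPrism-≈ₚ⁻ (_ , inj₂ refl) (_ , inj₂ refl) = inj₁ (refl , refl)

_↝_ : Pair → Pair → Set
(h , o) ↝ (h′ , o′) = (h′ ≡ h ⊎ h′ ≡ o) × o′ ≢ h × o′ ≢ o

lastOf : ∀ {A : Set} → A → List A → A
lastOf x []       = x
lastOf x (y ∷ xs) = lastOf y xs

Linked-++ : ∀ {A : Set} {R : A → A → Set} x xs {ys} →
            Linked R (x ∷ xs) → Linked R (lastOf x xs ∷ ys) → Linked R (x ∷ xs ++ ys)
Linked-++ x []       _        l  = l
Linked-++ x (y ∷ xs) (r ∷ l) l′ = r ∷ Linked-++ y xs l l′

lastOf-++ : ∀ {A : Set} (x : A) xs ys → lastOf x (xs ++ ys) ≡ lastOf (lastOf x xs) ys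
lastOf-++ x []       ys = refl
lastOf-++ x (y ∷ xs) ys = lastOf-++ y xs ys

newPairs : ℕ → List Pair
newPairs k = (k , suc k) ∷ map (suc k ,_) (downFrom k)

laterPairs : ℕ → List Pair
laterPairs zero    = []
laterPairs (suc j) = laterPairs j ++ newPairs (suc j)

schedule : ℕ → List Pair
schedule j = (0 , 1) ∷ laterPairs j

_≤ₚ_ : Pair → ℕ → Set
(x , y) ≤ₚ b = x ≤ b × y ≤ b

_∋ₚ_ : Pair → ℕ → Set
(x , y) ∋ₚ z = x ≡ z ⊎ y ≡ z

descending-linked : ∀ J i → i < J → Linked _↝_ ((J , i) ∷ map (J ,_) (downFrom i))
descending-linked J zero    _   = [-]
descending-linked J (suc i) i<J =
  (inj₁ refl , <⇒≢ i<J′ , <⇒≢ (n<1+n i)) ∷ descending-linked J i i<J′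
  where i<J′ = <-trans (n<1+n i) i<J

lastOf-descending : ∀ J i → lastOf {A = Pair} (J , i) (map (J ,_) (downFrom i)) ≡ (J , 0)
lastOf-descending J zero    = refl
lastOf-descending J (suc i) = lastOf-descending J i

newPairs-linked : ∀ k → Linked _↝_ (newPairs k)
newPairs-linked zero    = [-]
newPairs-linked (suc k) =
  (inj₂ refl , <⇒≢ (n<1+n k) , <⇒≢ (<-trans (n<1+n k) (n<1+n (suc k)))) ∷
  descending-linked (suc (suc k)) k (<-trans (n<1+n k) (n<1+n (suc k)))

lastOf-laterPairs : ∀ j → lastOf {A = Pair} (0 , 1) (laterPairs (suc j)) ≡ (suc (suc j) , 0)
lastOf-laterPairs j =
  trans (lastOf-++ (0 , 1) (laterPairs j) (newPairs (suc j))) (lastOf-descending (suc (suc j)) j)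

schedule-linked : ∀ j → Linked _↝_ (schedule j)
schedule-linked zero    = [-]
schedule-linked (suc j) = Linked-++ (0 , 1) (laterPairs j) (schedule-linked j) (link j)
  where
  link : ∀ j → Linked _↝_ (lastOf (0 , 1) (laterPairs j) ∷ newPairs (suc j))
  link zero    = (inj₂ refl , (λ ()) , (λ ())) ∷ newPairs-linked 1
  link (suc j) rewrite lastOf-laterPairs j =
    (inj₁ refl , <⇒≢ (n<1+n (suc (suc j))) ∘ sym , (λ ())) ∷ newPairs-linked (suc (suc j))

newPairs-bounded : ∀ k → All (_≤ₚ suc k) (newPairs k)
newPairs-bounded k =
  (n≤1+n k , ≤-refl) ∷
  All.map⁺ (All.tabulate (λ i∈ → ≤-refl , <⇒≤ (<-trans (∈-downFrom⁻ i∈) (n<1+n k))))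

schedule-bounded : ∀ j → All (_≤ₚ suc j) (schedule j)
schedule-bounded zero    = (z≤n , ≤-refl) ∷ []
schedule-bounded (suc j) =
  All.++⁺ (All.map (λ (x≤ , y≤) → ≤-trans x≤ (n≤1+n _) , ≤-trans y≤ (n≤1+n _)) (schedule-bounded j))
          (newPairs-bounded (suc j))

newPairs-∋ : ∀ k → All (_∋ₚ suc k) (newPairs k)
newPairs-∋ k = inj₂ refl ∷ All.map⁺ (All.tabulate (λ _ → inj₁ refl))

≤ₚ-∌ : ∀ {b p q} → p ≤ₚ b → q ∋ₚ suc b → ¬ p ≈ₚ q
≤ₚ-∌ (x≤ , _) (inj₁ refl) (inj₁ (refl , _)) = <-irrefl refl (s≤s x≤)
≤ₚ-∌ (_ , y≤) (inj₂ refl) (inj₁ (_ , refl)) = <-irrefl refl (s≤s y≤)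
≤ₚ-∌ (_ , y≤) (inj₁ refl) (inj₂ (_ , refl)) = <-irrefl refl (s≤s y≤)
≤ₚ-∌ (x≤ , _) (inj₂ refl) (inj₂ (refl , _)) = <-irrefl refl (s≤s x≤)

newPairs-distinct : ∀ k → AllPairs (λ p q → ¬ p ≈ₚ q) (newPairs k)
newPairs-distinct k =
  All.map⁺ (All.tabulate (λ i∈ → first≉ (∈-downFrom⁻ i∈))) ∷
  AllPairs.map⁺ (AllPairs.map later≉ (Unique.downFrom⁺ k))
  where
  first≉ : ∀ {i} → i < k → ¬ (k , suc k) ≈ₚ (suc k , i)
  first≉ _   (inj₁ (k≡ , _)) = <⇒≢ (n<1+n k) k≡
  first≉ i<k (inj₂ (refl , _)) = <-irrefl refl i<k
  later≉ : ∀ {i i′} → i ≢ i′ → ¬ (suc k , i) ≈ₚ (suc k , i′)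
  later≉ i≢i′ (inj₁ (_ , i≡i′))    = i≢i′ i≡i′
  later≉ i≢i′ (inj₂ (refl , refl)) = i≢i′ refl

schedule-distinct : ∀ j → AllPairs (λ p q → ¬ p ≈ₚ q) (schedule j)
schedule-distinct zero    = [] ∷ []
schedule-distinct (suc j) =
  AllPairs.++⁺ (schedule-distinct j) (newPairs-distinct (suc j))
    (All.map (λ p≤ → All.map (≤ₚ-∌ p≤) (newPairs-∋ (suc j))) (schedule-bounded j))

newPairs-⊆ : ∀ {P : Pair → Set} {k} j → k ≤ j → Any P (newPairs k) → Any P (schedule j)
newPairs-⊆ zero    z≤n a = a
newPairs-⊆ (suc j) k≤ a with m≤n⇒m<n∨m≡n k≤
... | inj₂ refl = Any.++⁺ʳ (schedule j) a
... | inj₁ k<   = Any.++⁺ˡ (newPairs-⊆ j (≤-pred k<) a)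

schedule-complete-< : ∀ j {x y} → x < y → y ≤ suc j → Any (_≈ₚ (x , y)) (schedule j)
schedule-complete-< j {x} {suc k} x<y y≤ with m≤n⇒m<n∨m≡n (≤-pred x<y)
... | inj₂ refl = newPairs-⊆ j (≤-pred y≤) (here (inj₁ (refl , refl)))
... | inj₁ x<k  =
  newPairs-⊆ j (≤-pred y≤)
    (there (Any.map⁺ (Any.map (λ { refl → inj₂ (refl , refl) }) (∈-downFrom⁺ x<k))))

schedule-complete : ∀ j {x y} → x ≢ y → x ≤ suc j → y ≤ suc j → Any (_≈ₚ (x , y)) (schedule j)
schedule-complete j {x} {y} x≢y x≤ y≤ with <-cmp x y
... | tri< x<y _ _ = schedule-complete-< j x<y y≤
... | tri≈ _ x≡y _ = ⊥-elim (x≢y x≡y)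
... | tri> _ _ y<x = Any.map swapʳ (schedule-complete-< j y<x x≤)
  where
  swapʳ : ∀ {p} → p ≈ₚ (y , x) → p ≈ₚ (x , y)
  swapʳ (inj₁ (refl , refl)) = inj₂ (refl , refl)
  swapʳ (inj₂ (refl , refl)) = inj₁ (refl , refl)

module Arrangements (S : List ℕ) (S! : Unique S) (5≤|S| : 5 ≤ length S) where

  record Enumerates (p : Pair) (B : List (List ℕ)) : Set where
    field
      unique   : Unique B
      sound    : ∀ {v} → v ∈ B → v ↭ S × InPrism p v
      complete : ∀ {v} → v ↭ S → InPrism p v → v ∈ B

  Enumerates-≈ₚ : ∀ {p q B} → p ≈ₚ q → Enumerates p B → Enumerates q B
  Enumerates-≈ₚ p≈q e = record
    { unique   = unique
    ; sound    = λ v∈ → proj₁ (sound v∈) , InPrism-≈ₚ p≈q (proj₂ (sound v∈))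
    ; complete = λ v↭ pv → complete v↭ (InPrism-≈ₚ (≈ₚ-sym p≈q) pv)
    }
    where open Enumerates e

  module _ {h o A} (start : h ∷ o ∷ A ↭ S) where

    front-≢ : h ≢ o
    front-≢ with Unique-resp-↭ start S!
    ... | (h≢o ∷ _) ∷ _ = h≢o

    rest-unique : Unique A
    rest-unique with Unique-resp-↭ start S!
    ... | _ ∷ _ ∷ A! = A!

    ∈-rest : ∀ {x} → x ∈ S → x ≢ h → x ≢ o → x ∈ A
    ∈-rest x∈S x≢h x≢o with ∈-resp-↭ (↭-sym start) x∈S
    ... | here x≡h         = ⊥-elim (x≢h x≡h)
    ... | there (here x≡o) = ⊥-elim (x≢o x≡o)
    ... | there (there x∈) = x∈

    3≤|rest| : 3 ≤ length A
    3≤|rest| with subst (5 ≤_) (sym (↭-length start)) 5≤|S|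
    ... | s≤s (s≤s 3≤) = 3≤

    PrismVertex-↭ : ∀ {w v} → PrismVertex h o w v → w ↭ A → v ↭ S
    PrismVertex-↭ (inj₁ refl) w↭A = ↭-trans (↭-prep h (↭-prep o w↭A)) start
    PrismVertex-↭ (inj₂ refl) w↭A = ↭-trans (↭-swap o h w↭A) start

    PrismVertex-↭⁻ : ∀ {w v} → PrismVertex h o w v → v ↭ S → w ↭ A
    PrismVertex-↭⁻ (inj₁ refl) v↭S = drop-∷ (drop-∷ (↭-trans v↭S (↭-sym start)))
    PrismVertex-↭⁻ (inj₂ refl) v↭S =
      drop-∷ (drop-∷ (↭-trans (↭-swap h o ↭-refl) (↭-trans v↭S (↭-sym start))))

    PrismBlock-enumerates : ∀ {T} (b : PrismBlock h o A T) → Enumerates (h , o) (PrismBlock.vertices b)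
    PrismBlock-enumerates b = record
      { unique   = unique
      ; sound    = λ v∈ → let w , w↭A , pv = sound v∈ in PrismVertex-↭ pv w↭A , w , pv
      ; complete = λ v↭S (w , pv) → complete (PrismVertex-↭⁻ pv v↭S) pv
      }
      where open PrismBlock b

    handover : ∀ {h′ o′} → (h , o) ↝ (h′ , o′) → o′ ∈ S → ∀ s →
               ∃₂ λ x T → ∃ λ A′ → x ↭ A × PrismVertex h o x T × sign T ≡ s × T ⇄ h′ ∷ o′ ∷ A′
    handover (inj₁ refl , o′≢h , o′≢o) o′∈S s
      with sign-adjusted h o (∈-rest o′∈S o′≢h o′≢o) 3≤|rest| rest-unique s
    ... | r , x↭A , T-sign = _ , _ , o ∷ r , x↭A , inj₁ refl , T-sign , skip (swap (o′≢o ∘ sym))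
    handover (inj₂ refl , o′≢h , o′≢o) o′∈S s
      with sign-adjusted o h (∈-rest o′∈S o′≢h o′≢o) 3≤|rest| rest-unique s
    ... | r , x↭A , T-sign = _ , _ , h ∷ r , x↭A , inj₂ refl , T-sign , skip (swap (o′≢h ∘ sym))

  front-pair-arrangement : ∀ {x y} → x ∈ S → y ∈ S → x ≢ y → ∃ λ w → x ∷ y ∷ w ↭ S
  front-pair-arrangement x∈S y∈S x≢y with ∈⇒front x∈S
  ... | r , xr↭S with ∈-resp-↭ (↭-sym xr↭S) y∈S
  ...   | here y≡x  = ⊥-elim (x≢y (sym y≡x))
  ...   | there y∈r with ∈⇒front y∈r
  ...     | w , yw↭r = w , ↭-trans (↭-prep _ yw↭r) xr↭S

  concatBlocks : List (Pair × List (List ℕ)) → List (List ℕ)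
  concatBlocks bs = concat (map proj₂ bs)

  record BlockWalk (u X : List ℕ) (ps : List Pair) : Set where
    field
      blocks     : List (Pair × List (List ℕ))
      path       : Path u X (concatBlocks blocks)
      enumerates : All (uncurry Enumerates) blocks
      pairs      : map proj₁ blocks ≡ ps

  -- Each block ends with the sign opposite to its start and is joined to the next by an edge,
  -- so every block starts with the sign of the first one.
  blockWalk : ∀ {h o A X} ps → h ∷ o ∷ A ↭ S → Linked _↝_ ((h , o) ∷ ps) → All (λ p → proj₂ p ∈ S) ps →
              X ↭ S → InPrism (lastOf (h , o) ps) X → sign X ≡ sign (h ∷ o ∷ A) ⁻¹ →
              BlockWalk (h ∷ o ∷ A) X ((h , o) ∷ ps)
  blockWalk {h} {o} {A} {X} [] start _ _ X↭S (x , X-vertex) X-sign = record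
    { blocks     = [ (h , o) , PrismBlock.vertices block ]
    ; path       = subst (Path _ X) (sym (++-identityʳ _)) (PrismBlock.path block)
    ; enumerates = PrismBlock-enumerates start block ∷ []
    ; pairs      = refl
    }
    where
    block = prismBlock (front-≢ start) (rest-unique start) (PrismVertex-↭⁻ start X-vertex X↭S) X-vertex X-sign
  blockWalk {h} {o} {A} {X} ((h′ , o′) ∷ ps) start (h↝ ∷ linked) (o′∈S ∷ ∈S) X↭S X-prism X-sign
    with handover start h↝ o′∈S (sign (h ∷ o ∷ A) ⁻¹)
  ... | x , T , A′ , x↭A , T-vertex , T-sign , T⇄ = record
    { blocks     = ((h , o) , PrismBlock.vertices block) ∷ BlockWalk.blocks walk
    ; path       = Path-join (PrismBlock.path block) T⇄ (BlockWalk.path walk)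
    ; enumerates = PrismBlock-enumerates start block ∷ BlockWalk.enumerates walk
    ; pairs      = cong ((h , o) ∷_) (BlockWalk.pairs walk)
    }
    where
    block = prismBlock (front-≢ start) (rest-unique start) x↭A T-vertex T-sign
    start′ : h′ ∷ o′ ∷ A′ ↭ S
    start′ = ↭-trans (↭-sym (⇄⇒↭ T⇄)) (PrismVertex-↭ start T-vertex x↭A)
    same-sign : sign (h′ ∷ o′ ∷ A′) ≡ sign (h ∷ o ∷ A)
    same-sign = trans (⇄-sign T⇄) (trans (cong _⁻¹ T-sign) (⁻¹-involutive _))
    walk = blockWalk ps start′ linked ∈S X↭S X-prism (trans X-sign (cong _⁻¹ (sym same-sign)))

  Enumerates-disjoint : ∀ {p q B C} → Enumerates p B → Enumerates q C → ¬ p ≈ₚ q → Disjoint B C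
  Enumerates-disjoint eB eC p≉q (v∈B , v∈C) =
    p≉q (InPrism-≈ₚ⁻ (proj₂ (Enumerates.sound eB v∈B)) (proj₂ (Enumerates.sound eC v∈C)))

  blocks-disjoint : ∀ {bs} → All (uncurry Enumerates) bs → AllPairs (λ p q → ¬ p ≈ₚ q) (map proj₁ bs) →
                    AllPairs (λ b c → Disjoint (proj₂ b) (proj₂ c)) bs
  blocks-disjoint []       []         = []
  blocks-disjoint (e ∷ es) (p≉ ∷ p≉s) =
    All.zipWith (λ (e′ , p≉q) {v} → Enumerates-disjoint e e′ p≉q {v}) (es , All.map⁻ p≉) ∷
    blocks-disjoint es p≉s

  blocks-sound : ∀ {bs} → All (uncurry Enumerates) bs → ∀ {v} → v ∈ concatBlocks bs → v ↭ S
  blocks-sound {(_ , B) ∷ _} (e ∷ es) v∈ with ∈-++⁻ B v∈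
  ... | inj₁ v∈B  = proj₁ (Enumerates.sound e v∈B)
  ... | inj₂ v∈Bs = blocks-sound es v∈Bs

  ↭S⇒front : ∀ {v} → v ↭ S → ∃₂ λ x y → ∃ λ w → v ≡ x ∷ y ∷ w × x ≢ y
  ↭S⇒front {x ∷ y ∷ w} v↭S with Unique-resp-↭ v↭S S!
  ... | (x≢y ∷ _) ∷ _ = x , y , w , refl , x≢y
  ↭S⇒front {[]}    v↭S with subst (5 ≤_) (sym (↭-length v↭S)) 5≤|S|
  ... | ()
  ↭S⇒front {_ ∷ []} v↭S with subst (5 ≤_) (sym (↭-length v↭S)) 5≤|S|
  ... | s≤s ()

  module Walk {u X ps} (W : BlockWalk u X ps) where

    open BlockWalk W

    walk-sound : ∀ {v} → v ∈ concatBlocks blocks → v ↭ S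
    walk-sound = blocks-sound enumerates

    walk-unique : AllPairs (λ p q → ¬ p ≈ₚ q) ps → Unique (concatBlocks blocks)
    walk-unique distinct =
      Unique.concat⁺ (All.map⁺ (All.map Enumerates.unique enumerates))
                     (AllPairs.map⁺ (blocks-disjoint enumerates (subst (AllPairs _) (sym pairs) distinct)))

    walk-segment : ∀ {q} → Any (_≈ₚ q) ps →
                   ∃₂ λ pre B → ∃ λ post → concatBlocks blocks ≡ pre ++ B ++ post × Enumerates q B
    walk-segment q∈ with find (Any.map⁻ (subst (Any _) (sym pairs) q∈))
    ... | (p , B) , b∈ , p≈q with ∈-∃++ b∈
    ...   | pre , post , eq =
      concatBlocks pre , B , concatBlocks post , segment , Enumerates-≈ₚ p≈q (All.lookup enumerates b∈)
      where
      segment : concatBlocks blocks ≡ concatBlocks pre ++ B ++ concatBlocks post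
      segment = begin
        concat (map proj₂ blocks)                            ≡⟨ cong (concat ∘ map proj₂) eq ⟩
        concat (map proj₂ (pre ++ (p , B) ∷ post))           ≡⟨ cong concat (map-++ proj₂ pre _) ⟩
        concat (map proj₂ pre ++ B ∷ map proj₂ post)         ≡⟨ concat-++ (map proj₂ pre) _ ⟨
        concatBlocks pre ++ B ++ concatBlocks post           ∎
        where open ≡-Reasoning

    walk-complete : (∀ {x y} → x ∈ S → y ∈ S → x ≢ y → Any (_≈ₚ (x , y)) ps) →
                    ∀ {v} → v ↭ S → v ∈ concatBlocks blocks
    walk-complete covered v↭S with ↭S⇒front v↭S
    ... | x , y , w , refl , x≢y
      with walk-segment (covered (∈-resp-↭ v↭S (here refl)) (∈-resp-↭ v↭S (there (here refl))) x≢y)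
    ...   | pre , B , post , eq , e =
      subst (_ ∈_) (sym eq) (∈-++⁺ʳ pre (∈-++⁺ˡ (Enumerates.complete e v↭S (w , inj₁ refl))))

2≤length : ∀ {A : Set} {x y : A} {xs} → x ∈ xs → y ∈ xs → x ≢ y → 2 ≤ length xs
2≤length (here refl) (here refl) x≢y = ⊥-elim (x≢y refl)
2≤length (here _)    (there y∈)  _   = s≤s (∈-length y∈)
2≤length (there x∈)  _           _   = s≤s (∈-length x∈)

∈-tail : ∀ {A : Set} {x y : A} {ys} → x ∈ y ∷ ys → x ≢ y → x ∈ ys
∈-tail (here x≡y) x≢y = ⊥-elim (x≢y x≡y)
∈-tail (there x∈) _   = x∈

lookup-injective : ∀ {A : Set} {xs : List A} → Unique xs → ∀ {i j} → lookup xs i ≡ lookup xs j → i ≡ j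
lookup-injective {xs = x ∷ xs} _          {fzero}  {fzero}  _  = refl
lookup-injective {xs = x ∷ xs} (x∉ ∷ _)   {fzero}  {fsuc j} eq = ⊥-elim (All.lookup x∉ (∈-lookup j) eq)
lookup-injective {xs = x ∷ xs} (x∉ ∷ _)   {fsuc i} {fzero}  eq = ⊥-elim (All.lookup x∉ (∈-lookup i) (sym eq))
lookup-injective {xs = x ∷ xs} (_ ∷ xs!)  {fsuc i} {fsuc j} eq = cong fsuc (lookup-injective xs! eq)

lookup-∈-front : ∀ {A : Set} (B post : List A) → Unique (B ++ post) → (k : Fin (length (B ++ post))) →
                 lookup (B ++ post) k ∈ B ⇔ toℕ k < length B
lookup-∈-front []      post _          k      = mk⇔ (λ ()) (λ ())
lookup-∈-front (b ∷ B) post _          fzero  = mk⇔ (λ _ → s≤s z≤n) (λ _ → here refl)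
lookup-∈-front (b ∷ B) post (b∉ ∷ Bp!) (fsuc k) =
  ⇔-trans (mk⇔ later (there)) (⇔-trans (lookup-∈-front B post Bp! k) (mk⇔ s≤s ≤-pred))
  where
  later : lookup (B ++ post) k ∈ b ∷ B → lookup (B ++ post) k ∈ B
  later (here eq) = ⊥-elim (All.lookup b∉ (∈-lookup k) (sym eq))
  later (there m) = m

lookup-∈-segment : ∀ {A : Set} {xs : List A} pre B post → xs ≡ pre ++ B ++ post → Unique xs →
                   (k : Fin (length xs)) →
                   lookup xs k ∈ B ⇔ (length pre ≤ toℕ k × toℕ k < length pre + length B)
lookup-∈-segment []        B post refl xs! k = mk⇔ (λ m → z≤n , to m) (λ (_ , k<) → from k<)
  where open Equivalence (lookup-∈-front B post xs! k)
lookup-∈-segment (x ∷ pre) B post refl (x∉ ∷ _) fzero =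
  mk⇔ (λ x∈B → ⊥-elim (All.lookup x∉ (∈-++⁺ʳ pre (∈-++⁺ˡ x∈B)) refl)) (λ { (() , _) })
lookup-∈-segment (x ∷ pre) B post refl (_ ∷ xs!) (fsuc k) =
  ⇔-trans (lookup-∈-segment pre B post refl xs! k)
          (mk⇔ (λ (≤k , k<) → s≤s ≤k , s≤s k<) (λ (≤k , k<) → ≤-pred ≤k , ≤-pred k<))

Path-lookup-⇄ : ∀ {u v L} → Path u v L → (i j : Fin (length L)) → toℕ j ≡ suc (toℕ i) →
                lookup L i ⇄ lookup L j
Path-lookup-⇄ stop              fzero    fzero    ()
Path-lookup-⇄ (step a stop)     fzero    (fsuc fzero) _ = a
Path-lookup-⇄ (step a (step _ _)) fzero  (fsuc fzero) _ = a
Path-lookup-⇄ (step a p)        (fsuc i) (fsuc j) eq = Path-lookup-⇄ p i j (suc-injective eq)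

Path-lookup-last : ∀ {u v L} → Path u v L → (i : Fin (length L)) → suc (toℕ i) ≡ length L →
                   lookup L i ≡ v
Path-lookup-last stop              fzero    _  = refl
Path-lookup-last (step _ stop)     fzero    ()
Path-lookup-last (step _ (step _ _)) fzero  ()
Path-lookup-last (step _ p)        (fsuc i) eq = Path-lookup-last p i (suc-injective eq)

shift-mod : ∀ {N s k} .{{_ : NonZero N}} → s ≤ k → k < N → s ≤ N → (k + (N ∸ s)) % N ≡ k ∸ s
shift-mod {N} {s} {k} s≤k k<N s≤N = begin
  (k + (N ∸ s)) % N          ≡⟨ cong (λ x → (x + (N ∸ s)) % N) (m∸n+n≡m s≤k) ⟨
  (k ∸ s + s + (N ∸ s)) % N  ≡⟨ cong (_% N) (+-assoc (k ∸ s) s (N ∸ s)) ⟩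
  (k ∸ s + (s + (N ∸ s))) % N ≡⟨ cong (λ x → (k ∸ s + x) % N) (m+[n∸m]≡n s≤N) ⟩
  (k ∸ s + N) % N            ≡⟨ [m+n]%n≡m%n (k ∸ s) N ⟩
  (k ∸ s) % N                ≡⟨ m<n⇒m%n≡m (≤-<-trans (m∸n≤m k s) k<N) ⟩
  k ∸ s                      ∎
  where open ≡-Reasoning

cyclic-window : ∀ {N s L k} .{{_ : NonZero N}} → s + L ≤ N → k < N →
                (k + (N ∸ s)) % N < L ⇔ (s ≤ k × k < s + L)
cyclic-window {N} {s} {L} {k} s+L≤N k<N with s ≤? k
... | yes s≤k rewrite shift-mod s≤k k<N (≤-trans (m≤m+n s L) s+L≤N) = mk⇔ to from
  where
  to : k ∸ s < L → s ≤ k × k < s + L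
  to k∸s<L = s≤k , subst (_< s + L) (m+[n∸m]≡n s≤k) (+-monoʳ-< s k∸s<L)
  from : s ≤ k × k < s + L → k ∸ s < L
  from (_ , k<s+L) = subst (k ∸ s <_) (m+n∸m≡n s L) (∸-monoˡ-< k<s+L s≤k)
... | no s≰k = mk⇔ (λ lt → ⊥-elim (<⇒≱ lt L≤)) (λ (s≤k , _) → ⊥-elim (s≰k s≤k))
  where
  s≤N = ≤-trans (m≤m+n s L) s+L≤N
  small : k + (N ∸ s) < N
  small = subst (k + (N ∸ s) <_) (m+[n∸m]≡n s≤N) (+-monoˡ-< (N ∸ s) (≰⇒> s≰k))
  L≤ : L ≤ (k + (N ∸ s)) % N
  L≤ = subst (L ≤_) (sym (m<n⇒m%n≡m small))
         (≤-trans (subst (_≤ N ∸ s) (m+n∸m≡n s L) (∸-monoˡ-≤ s s+L≤N)) (m≤n+m (N ∸ s) k))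

at : List ℕ → ℕ → ℕ
at []      _       = 0
at (x ∷ w) zero    = x
at (x ∷ w) (suc i) = at w i

at-∈ : ∀ w {i} → i < length w → at w i ∈ w
at-∈ (x ∷ w) {zero}  _         = here refl
at-∈ (x ∷ w) {suc i} (s≤s i<) = there (at-∈ w i<)

at-injective : ∀ {w} → Unique w → ∀ {i j} → i < length w → j < length w → at w i ≡ at w j → i ≡ j
at-injective {x ∷ w} _         {zero}  {zero}  _        _        _  = refl
at-injective {x ∷ w} (x∉ ∷ _)  {zero}  {suc j} _        (s≤s j<) eq =
  ⊥-elim (All.lookup x∉ (at-∈ w j<) eq)
at-injective {x ∷ w} (x∉ ∷ _)  {suc i} {zero}  (s≤s i<) _        eq =
  ⊥-elim (All.lookup x∉ (at-∈ w i<) (sym eq))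
at-injective {x ∷ w} (_ ∷ w!)  {suc i} {suc j} (s≤s i<) (s≤s j<) eq =
  cong suc (at-injective w! i< j< eq)

at-ext : ∀ u v → length u ≡ length v → (∀ i → i < length u → at u i ≡ at v i) → u ≡ v
at-ext []      []      _   _  = refl
at-ext (x ∷ u) (y ∷ v) len eq =
  cong₂ _∷_ (eq 0 (s≤s z≤n)) (at-ext u v (suc-injective len) (λ i i< → eq (suc i) (s≤s i<)))

at-tabulate : ∀ {m} (f : Fin m → ℕ) (i : Fin m) → at (List.tabulate f) (toℕ i) ≡ f i
at-tabulate f fzero    = refl
at-tabulate f (fsuc i) = at-tabulate (f ∘ fsuc) i

⇄-at : ∀ {u v} → u ⇄ v → ∃ λ i → suc i < length u × at v i ≡ at u (suc i) × at v (suc i) ≡ at u i ×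
       (∀ j → j ≢ i → j ≢ suc i → at v j ≡ at u j)
⇄-at (swap _) = 0 , s≤s (s≤s z≤n) , refl , refl , others
  where
  others : ∀ j → j ≢ 0 → j ≢ 1 → _
  others zero          j≢0 _   = ⊥-elim (j≢0 refl)
  others (suc zero)    _   j≢1 = ⊥-elim (j≢1 refl)
  others (suc (suc j)) _   _   = refl
⇄-at (skip a) with ⇄-at a
... | i , i< , eq₁ , eq₂ , others = suc i , s≤s i< , eq₁ , eq₂ , others′
  where
  others′ : ∀ j → j ≢ suc i → j ≢ suc (suc i) → _
  others′ zero    _   _   = refl
  others′ (suc j) j≢₁ j≢₂ = others j (j≢₁ ∘ cong suc) (j≢₂ ∘ cong suc)

injective⇒surjective : ∀ {m} (f : Fin m → Fin m) → (∀ {x y} → f x ≡ f y → x ≡ y) →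
                       ∀ y → ∃ λ x → f x ≡ y
injective⇒surjective {suc m} f f-inj y with Fin.any? (λ x → f x Fin.≟ y)
... | yes found  = found
... | no  missed = ⊥-elim (1+n≰n (Fin.injective⇒≤ punched-injective))
  where
  y≢f : ∀ x → y ≢ f x
  y≢f x y≡fx = missed (x , sym y≡fx)
  punched-injective : ∀ {x x′} → punchOut (y≢f x) ≡ punchOut (y≢f x′) → x ≡ x′
  punched-injective eq = f-inj (Fin.punchOut-injective (y≢f _) (y≢f _) eq)

opposite-injective : ∀ {m} {a b : Fin m} → opposite a ≡ opposite b → a ≡ b
opposite-injective eq =
  trans (sym (Fin.opposite-involutive _)) (trans (cong opposite eq) (Fin.opposite-involutive _))

module Words (k : ℕ) where

  private
    n : ℕ
    n = suc (suc k)

  S : List ℕ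
  S = upTo n

  listIndex : Fin n → ℕ
  listIndex p = toℕ (opposite p)

  -- Lists are read backwards, so the front pair of an arrangement gives the last two letters
  -- of its word. Entries are reduced mod n, which changes nothing on arrangements of S.
  word : List ℕ → Word n
  word v = Vec.tabulate (λ p → at v (listIndex p) mod n)

  lookup-word : ∀ v p → Vec.lookup (word v) p ≡ at v (listIndex p) mod n
  lookup-word v p = Vec.lookup∘tabulate (λ p → at v (listIndex p) mod n) p

  listIndex-injective : ∀ {p q} → listIndex p ≡ listIndex q → p ≡ q
  listIndex-injective = opposite-injective ∘ Fin.toℕ-injective

  position : ∀ {i} → i < n → Fin n
  position i<n = opposite (fromℕ< i<n)

  listIndex-position : ∀ {i} (i<n : i < n) → listIndex (position i<n) ≡ i
  listIndex-position i<n = trans (cong toℕ (Fin.opposite-involutive _)) (Fin.toℕ-fromℕ< i<n)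

  toℕ-mod : ∀ {x} → x < n → toℕ (x mod n) ≡ x
  toℕ-mod x<n = trans (Fin.toℕ-fromℕ< _) (m<n⇒m%n≡m x<n)

  mod-toℕ : ∀ (i : Fin n) → toℕ i mod n ≡ i
  mod-toℕ i = Fin.toℕ-injective (toℕ-mod (Fin.toℕ<n i))

  module _ {v} (v↭S : v ↭ S) where

    length-arrangement : length v ≡ n
    length-arrangement = trans (↭-length v↭S) (length-upTo n)

    at-< : ∀ {i} → i < n → at v i < n
    at-< i<n = ∈-upTo⁻ (∈-resp-↭ v↭S (at-∈ v (subst (_ <_) (sym length-arrangement) i<n)))

    toℕ-lookup-word : ∀ p → toℕ (Vec.lookup (word v) p) ≡ at v (listIndex p)
    toℕ-lookup-word p =
      trans (cong toℕ (lookup-word v p)) (toℕ-mod (at-< (Fin.toℕ<n (opposite p))))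

    at-lookup-word : ∀ {i} (i<n : i < n) → at v i ≡ toℕ (Vec.lookup (word v) (position i<n))
    at-lookup-word i<n = trans (cong (at v) (sym (listIndex-position i<n))) (sym (toℕ-lookup-word (position i<n)))

    word-isPerm : IsPerm (word v)
    word-isPerm p q eq =
      listIndex-injective (at-injective (Unique-resp-↭ v↭S (Unique.upTo⁺ n)) (index< p) (index< q)
        (trans (sym (toℕ-lookup-word p)) (trans (cong toℕ eq) (toℕ-lookup-word q))))
      where
      index< : ∀ p → listIndex p < length v
      index< p = subst (listIndex p <_) (sym length-arrangement) (Fin.toℕ<n (opposite p))

  lookup-word-position : ∀ v {i} (i<n : i < n) → Vec.lookup (word v) (position i<n) ≡ at v i mod n
  lookup-word-position v i<n =
    trans (lookup-word v (position i<n)) (cong (λ j → at v j mod n) (listIndex-position i<n))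

  toℕ-position : ∀ {i} (i<n : i < n) → toℕ (position i<n) ≡ n ∸ suc i
  toℕ-position i<n = trans (Fin.opposite-prop (fromℕ< i<n)) (cong (λ j → n ∸ suc j) (Fin.toℕ-fromℕ< i<n))

  word-injective : ∀ {u v} → u ↭ S → v ↭ S → word u ≡ word v → u ≡ v
  word-injective {u} {v} u↭S v↭S eq =
    at-ext u v (trans (length-arrangement u↭S) (sym (length-arrangement v↭S))) same-at
    where
    same-at : ∀ i → i < length u → at u i ≡ at v i
    same-at i i< = begin
      at u i                                        ≡⟨ at-lookup-word u↭S i<n ⟩
      toℕ (Vec.lookup (word u) (position i<n))      ≡⟨ cong (λ π → toℕ (Vec.lookup π (position i<n))) eq ⟩
      toℕ (Vec.lookup (word v) (position i<n))      ≡⟨ at-lookup-word v↭S i<n ⟨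
      at v i                                        ∎
      where
      open ≡-Reasoning
      i<n = subst (i <_) (length-arrangement u↭S) i<

  ⇄⇒BSAdj : ∀ {u v} → u ↭ S → u ⇄ v → BSAdj (word u) (word v)
  ⇄⇒BSAdj {u} {v} u↭S a with ⇄-at a
  ... | i , 1+i< , eq₁ , eq₂ , others = p , q , adjacent , swapped₁ , swapped₂ , unchanged
    where
    1+i<n = subst (suc i <_) (length-arrangement u↭S) 1+i<
    i<n   = <-trans (n<1+n i) 1+i<n
    p = position 1+i<n
    q = position i<n
    adjacent : toℕ q ≡ suc (toℕ p)
    adjacent = trans (toℕ-position i<n) (trans (+-∸-assoc 1 1+i<n) (cong suc (sym (toℕ-position 1+i<n))))
    swapped₁ : Vec.lookup (word v) p ≡ Vec.lookup (word u) q
    swapped₁ = trans (lookup-word-position v 1+i<n)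
                     (trans (cong (_mod n) eq₂) (sym (lookup-word-position u i<n)))
    swapped₂ : Vec.lookup (word v) q ≡ Vec.lookup (word u) p
    swapped₂ = trans (lookup-word-position v i<n)
                     (trans (cong (_mod n) eq₁) (sym (lookup-word-position u 1+i<n)))
    unchanged : ∀ x → x ≢ p → x ≢ q → Vec.lookup (word v) x ≡ Vec.lookup (word u) x
    unchanged x x≢p x≢q =
      trans (lookup-word v x) (trans (cong (_mod n) (others (listIndex x) ≢i ≢1+i)) (sym (lookup-word u x)))
      where
      ≢i : listIndex x ≢ i
      ≢i eq = x≢q (listIndex-injective (trans eq (sym (listIndex-position i<n))))
      ≢1+i : listIndex x ≢ suc i
      ≢1+i eq = x≢p (listIndex-injective (trans eq (sym (listIndex-position 1+i<n))))

  mod≡⇒≡toℕ : ∀ {x} {i : Fin n} → x < n → x mod n ≡ i → x ≡ toℕ i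
  mod≡⇒≡toℕ x<n eq = trans (sym (toℕ-mod x<n)) (cong toℕ eq)

  lookup-word-front : ∀ {x y w} (p q : Fin n) → toℕ p ≡ k → toℕ q ≡ suc k →
                      Vec.lookup (word (x ∷ y ∷ w)) p ≡ y mod n × Vec.lookup (word (x ∷ y ∷ w)) q ≡ x mod n
  lookup-word-front {x} {y} {w} p q p≡k q≡1+k =
    trans (lookup-word (x ∷ y ∷ w) p) (cong (λ j → at (x ∷ y ∷ w) j mod n) index-p) ,
    trans (lookup-word (x ∷ y ∷ w) q) (cong (λ j → at (x ∷ y ∷ w) j mod n) index-q)
    where
    index-p : listIndex p ≡ 1
    index-p = trans (Fin.opposite-prop p) (trans (cong (λ t → n ∸ suc t) p≡k) (m+n∸n≡m 1 k))
    index-q : listIndex q ≡ 0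
    index-q = trans (Fin.opposite-prop q) (trans (cong (λ t → n ∸ suc t) q≡1+k) (n∸n≡0 (suc k)))

  InP-word : ∀ {v} → v ↭ S → ∀ i j → InP i j (word v) ⇔ InPrism (toℕ j , toℕ i) v
  InP-word {[]}    v↭S with length-arrangement v↭S
  ... | ()
  InP-word {_ ∷ []} v↭S with length-arrangement v↭S
  ... | ()
  InP-word {x ∷ y ∷ w} v↭S i j = mk⇔ to from
    where
    x<n = at-< v↭S {0} (s≤s z≤n)
    y<n = at-< v↭S {1} (s≤s (s≤s z≤n))
    to : InP i j (word (x ∷ y ∷ w)) → InPrism (toℕ j , toℕ i) (x ∷ y ∷ w)
    to (p , q , p≡ , q≡ , letters) with lookup-word-front {x} {y} {w} p q p≡ q≡ | letters
    ... | yp , xq | inj₁ (p-i , q-j) =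
      w , inj₁ (cong₂ (λ a b → a ∷ b ∷ w) (mod≡⇒≡toℕ x<n (trans (sym xq) q-j))
                                          (mod≡⇒≡toℕ y<n (trans (sym yp) p-i)))
    ... | yp , xq | inj₂ (p-j , q-i) =
      w , inj₂ (cong₂ (λ a b → a ∷ b ∷ w) (mod≡⇒≡toℕ x<n (trans (sym xq) q-i))
                                          (mod≡⇒≡toℕ y<n (trans (sym yp) p-j)))
    k<n : k < n
    k<n = <-trans (n<1+n k) (n<1+n (suc k))
    p₀≡ = Fin.toℕ-fromℕ< k<n
    q₀≡ = Fin.toℕ-fromℕ< (n<1+n (suc k))
    front₀ = lookup-word-front {x} {y} {w} _ _ p₀≡ q₀≡
    from : InPrism (toℕ j , toℕ i) (x ∷ y ∷ w) → InP i j (word (x ∷ y ∷ w))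
    from (_ , inj₁ refl) =
      _ , _ , p₀≡ , q₀≡ , inj₁ (trans (proj₁ front₀) (mod-toℕ i) , trans (proj₂ front₀) (mod-toℕ j))
    from (_ , inj₂ refl) =
      _ , _ , p₀≡ , q₀≡ , inj₂ (trans (proj₁ front₀) (mod-toℕ j) , trans (proj₂ front₀) (mod-toℕ i))

  word-surjective : ∀ (π : Word n) → IsPerm π → ∃ λ v → v ↭ S × word v ≡ π
  word-surjective π π-perm = v , v↭S , trans (Vec.tabulate-cong letter) (Vec.tabulate∘lookup π)
    where
    f : Fin n → ℕ
    f i = toℕ (Vec.lookup π (opposite i))
    v = List.tabulate f
    to : ∀ {z} → z ∈ v → z ∈ S
    to z∈ with ∈-tabulate⁻ {f = f} z∈
    ... | i , refl = ∈-upTo⁺ (Fin.toℕ<n _)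
    from : ∀ {z} → z ∈ S → z ∈ v
    from z∈ with injective⇒surjective (Vec.lookup π) (π-perm _ _) (fromℕ< (∈-upTo⁻ z∈))
    ... | q , eq = subst (_∈ v) fq≡z (∈-tabulate⁺ {f = f} (opposite q))
      where
      fq≡z : f (opposite q) ≡ _
      fq≡z = trans (cong (λ x → toℕ (Vec.lookup π x)) (Fin.opposite-involutive q))
                   (trans (cong toℕ eq) (Fin.toℕ-fromℕ< _))
    v↭S : v ↭ S
    v↭S = ∼bag⇒↭ (unique∧set⇒bag (Unique.tabulate⁺ (opposite-injective ∘ π-perm _ _ ∘ Fin.toℕ-injective))
                                 (Unique.upTo⁺ n) (mk⇔ to from))
    letter : ∀ p → at v (listIndex p) mod n ≡ Vec.lookup π p
    letter p = begin
      at v (toℕ (opposite p)) mod n                     ≡⟨ cong (_mod n) (at-tabulate f (opposite p)) ⟩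
      toℕ (Vec.lookup π (opposite (opposite p))) mod n  ≡⟨ cong (λ x → toℕ (Vec.lookup π x) mod n)
                                                              (Fin.opposite-involutive p) ⟩
      toℕ (Vec.lookup π p) mod n                        ≡⟨ mod-toℕ _ ⟩
      Vec.lookup π p                                    ∎
      where open ≡-Reasoning

-- The Hamiltonian cycle

module BubbleSortCycle (m : ℕ) (2≤m : 2 ≤ m) where

  n : ℕ
  n = suc (suc (suc m))

  open Words (suc m)

  5≤|S| : 5 ≤ length S
  5≤|S| = subst (5 ≤_) (sym (length-upTo n)) (s≤s (s≤s (s≤s 2≤m)))

  open Arrangements S (Unique.upTo⁺ n) 5≤|S|

  mid : List ℕ
  mid = applyUpTo (suc ∘ suc) m

  -- X is adjacent to start and lies in the prism of the last pair (suc (suc m) , 0).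
  start X : List ℕ
  start = 0 ∷ 1 ∷ suc (suc m) ∷ mid
  X     = 0 ∷ suc (suc m) ∷ 1 ∷ mid

  start↭S : start ↭ S
  start↭S =
    ↭-prep 0 (↭-prep 1 (↭-trans (∷↭∷ʳ (suc (suc m)) mid) (↭-reflexive (applyUpTo-∷ʳ (suc ∘ suc) m))))

  start⇄X : start ⇄ X
  start⇄X = skip (swap (λ ()))

  X↭S : X ↭ S
  X↭S = ↭-trans (↭-sym (⇄⇒↭ start⇄X)) start↭S

  -- Opaque, so that type checking never unfolds the construction.
  opaque
    walk : BlockWalk start X (schedule (suc m))
    walk = blockWalk (laterPairs (suc m)) start↭S (schedule-linked (suc m)) seconds∈S
                     X↭S X-prism (⇄-sign start⇄X)
      where
      seconds∈S : All (λ p → proj₂ p ∈ S) (laterPairs (suc m))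
      seconds∈S = All.map (λ (_ , y≤) → ∈-upTo⁺ (s≤s y≤)) (All.tail (schedule-bounded (suc m)))
      X-prism : InPrism (lastOf (0 , 1) (laterPairs (suc m))) X
      X-prism = subst (λ p → InPrism p X) (sym (lastOf-laterPairs m)) (1 ∷ mid , inj₂ refl)

  open Walk walk

  covered : ∀ {x y} → x ∈ S → y ∈ S → x ≢ y → Any (_≈ₚ (x , y)) (schedule (suc m))
  covered x∈ y∈ x≢y = schedule-complete (suc m) x≢y (≤-pred (∈-upTo⁻ x∈)) (≤-pred (∈-upTo⁻ y∈))

  C′ : List (List ℕ)
  C′ = proj₁ (Path-∷ (BlockWalk.path walk))

  cycle≡ : concatBlocks (BlockWalk.blocks walk) ≡ start ∷ C′
  cycle≡ = proj₂ (Path-∷ (BlockWalk.path walk))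

  M : ℕ
  M = length C′

  c : Fin (suc M) → Word n
  c k = word (lookup (start ∷ C′) k)

  cycle-path : Path start X (start ∷ C′)
  cycle-path = subst (Path start X) cycle≡ (BlockWalk.path walk)

  cycle-unique : Unique (start ∷ C′)
  cycle-unique = subst Unique cycle≡ (walk-unique (schedule-distinct (suc m)))

  cycle-complete : ∀ {v} → v ↭ S → v ∈ start ∷ C′
  cycle-complete v↭S = subst (_ ∈_) cycle≡ (walk-complete covered v↭S)

  entry↭S : ∀ k → lookup (start ∷ C′) k ↭ S
  entry↭S k = walk-sound (subst (lookup (start ∷ C′) k ∈_) (sym cycle≡) (∈-lookup k))

  3≤length : 3 ≤ suc M
  3≤length =
    s≤s (2≤length (∈-tail (cycle-complete X↭S) X≢start) (∈-tail (cycle-complete Y↭S) (λ ())) (λ ()))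
    where
    Y↭S : 1 ∷ 0 ∷ suc (suc m) ∷ mid ↭ S
    Y↭S = ↭-trans (↭-swap 1 0 ↭-refl) start↭S
    X≢start : X ≢ start
    X≢start eq with ∷-injectiveˡ (∷-injectiveʳ eq)
    ... | ()

  covers : (π : Word n) → IsPerm π → ∃[ k ] (c k ≡ π)
  covers π π-perm with word-surjective π π-perm
  ... | v , v↭S , refl = Any.index v∈ , cong word (sym (Any.lookup-index v∈))
    where v∈ = cycle-complete v↭S

  adjacent : (k l : Fin (suc M)) → toℕ l ≡ suc (toℕ k) % suc M → BSAdj (c k) (c l)
  adjacent k l l≡ with m≤n⇒m<n∨m≡n (Fin.toℕ<n k)
  ... | inj₁ 1+k<1+M =
    ⇄⇒BSAdj (entry↭S k) (Path-lookup-⇄ cycle-path k l (trans l≡ (m<n⇒m%n≡m 1+k<1+M)))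
  ... | inj₂ 1+k≡1+M
    with Fin.toℕ-injective {i = l} {j = fzero} (trans l≡ (trans (cong (_% suc M) 1+k≡1+M) (n%n≡0 (suc M))))
  ...   | refl = subst (λ v → BSAdj (word v) (c fzero)) (sym (Path-lookup-last cycle-path k 1+k≡1+M))
                   (⇄⇒BSAdj X↭S (⇄-sym start⇄X))

  hamiltonian : HamCycleBS n M c
  hamiltonian = record
    { length≥3 = 3≤length
    ; distinct = λ k l eq → lookup-injective cycle-unique (word-injective (entry↭S k) (entry↭S l) eq)
    ; perms    = λ k → word-isPerm (entry↭S k)
    ; covers   = covers
    ; adjacent = adjacent
    }

  toℕ∈S : ∀ (i : Fin n) → toℕ i ∈ S
  toℕ∈S i = ∈-upTo⁺ (Fin.toℕ<n i)

  toℕ-≢ : ∀ {i j : Fin n} → i ≢ j → toℕ j ≢ toℕ i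
  toℕ-≢ i≢j = i≢j ∘ sym ∘ Fin.toℕ-injective

  consecutive : (i j : Fin n) → i ≢ j → ConsecutiveIn {n} {M} c i j
  consecutive i j i≢j with walk-segment (covered (toℕ∈S j) (toℕ∈S i) (toℕ-≢ i≢j))
  ... | pre , B , post , segment , B-prism = fromℕ< pre<N , length B , window
    where
    open Enumerates B-prism
    segment′ : start ∷ C′ ≡ pre ++ B ++ post
    segment′ = trans (sym cycle≡) segment
    pre+B≤N : length pre + length B ≤ suc M
    pre+B≤N = begin
      length pre + length B                    ≤⟨ +-monoʳ-≤ (length pre) (m≤m+n (length B) (length post)) ⟩
      length pre + (length B + length post)    ≡⟨ cong (length pre +_) (length-++ B) ⟨
      length pre + length (B ++ post)          ≡⟨ length-++ pre ⟨
      length (pre ++ B ++ post)                ≡⟨ cong length segment′ ⟨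
      suc M                                    ∎
      where open ≤-Reasoning
    B-nonempty : 0 < length B
    B-nonempty with front-pair-arrangement (toℕ∈S j) (toℕ∈S i) (toℕ-≢ i≢j)
    ... | w , v↭S = ∈-length (complete v↭S (w , inj₁ refl))
    pre<N : length pre < suc M
    pre<N = <-≤-trans (m<m+n (length pre) B-nonempty) pre+B≤N
    window : (k : Fin (suc M)) → InP i j (c k) ⇔ ((toℕ k + (suc M ∸ toℕ (fromℕ< pre<N))) % suc M < length B)
    window k rewrite Fin.toℕ-fromℕ< pre<N =
      ⇔-trans (InP-word (entry↭S k) i j)
      (⇔-trans (mk⇔ (complete (entry↭S k)) (proj₂ ∘ sound))
      (⇔-trans (lookup-∈-segment pre B post segment′ cycle-unique k)
               (⇔-sym (cyclic-window pre+B≤N (Fin.toℕ<n k)))))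

theorem3 : (n : ℕ) → 5 ≤ n →
    ∃[ M ] ∃[ c ] (HamCycleBS n M c
    × ((i j : Fin n) → i ≢ j → ConsecutiveIn {n} {M} c i j))
theorem3 (suc (suc (suc m))) (s≤s (s≤s (s≤s 2≤m))) = M , c , hamiltonian , consecutive
  where open BubbleSortCycle m 2≤m
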